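{- Let $f=\sum_{i=1}^\ell P_i$ be a homogeneous monotone polynomial of degree $d\ge 1$ with $\mathrm{var}(P_i)\cap\mathrm{var}(P_j)=\emptyset$ for all $i\ne j$. Let $C$ be a good minimal monotone circuit with $\mathrm{mon}(C)\subseteq\mathrm{mon}(f)$. If a gate $g$ of $C$ computes a polynomial $p$ of degree less than $d$, or a product of two such polynomials, then $\mathrm{var}(p)\subseteq\mathrm{var}(P_i)$ for a unique $i$.
   Context: Polynomials are commutative over $\mathbb{R}$; monotone means all coefficients (resp. all circuit constants) are nonnegative. For a polynomial $q$, $\mathrm{mon}(q)$ is the set of monomials with nonzero coefficient and $\mathrm{var}(q)$ the set of variables occurring in them; for a circuit $C$, $\mathrm{mon}(C),\mathrm{var}(C)$ refer to the polynomial it computes. Circuits are layered (nodes partitioned into layers $V_1,\dots,V_t$, $V_1$ leaves, children of nodes in $V_i$ lie in $V_1\cup V_{i-1}$, internal gates $+$ or $\times$ of indegree two), width is $\max_{i>1}|V_i|$, size is the number of nodes. A layered circuit $C$ is minimal if there is no smaller circuit $C'$ of the same width with $\mathrm{mon}(C')=\mathrm{mon}(C)$. A minimal monotone circuit is good if: (i) the only constants used are $0$ and $1$ and no gate is multiplied by a constant; (ii) every node has a path to the output, so for every node computing $p$ there is a monomial $m$ with $\mathrm{mon}(m\cdot p)\subseteq\mathrm{mon}(C)$ (in particular if $C$ computes a homogeneous multilinear polynomial then so does every node); (iii) if $C$ computes a homogeneous multilinear polynomial of degree $d$ and a node $g$ in layer $i$ computes a polynomial $p$ of degree $d$, then in layer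 $i+1$ there is a sum gate $g'$ having $g$ as a child (so $g'$ computes a homogeneous multilinear $p'$ of degree $d$ with $\mathrm{mon}(p)\subseteq\mathrm{mon}(p')$).
   Formalization: The polynomials $P_i$, and so $f$, have rational coefficients rather than real ones. -}

module Defs where

open import Data.Nat using (ℕ; zero; suc; _≤_; _<_; _⊔_) renaming (_+_ to _+ℕ_; _≟_ to _≟ℕ_)
open import Data.Fin using (Fin)
open import Data.Vec using (Vec; lookup; zipWith; replicate; _[_]≔_) renaming (sum to vsum)
open import Data.Vec.Properties using (≡-dec)
open import Data.List using (List; []; _∷_; _++_; concatMap; concat; map)
import Data.List as List
open import Data.Rational using (ℚ; 0ℚ; 1ℚ; _+_; _*_) renaming (_≤_ to _≤ℚ_)
open import Data.Product using (Σ; ∃; _×_; _,_)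
open import Data.Sum using (_⊎_; inj₁; inj₂)
open import Data.Empty using (⊥)
open import Data.Unit using (⊤)
open import Data.Bool using (if_then_else_)
open import Relation.Nullary using (¬_)
open import Relation.Nullary.Decidable using (⌊_⌋)
open import Relation.Binary.PropositionalEquality using (_≡_)

-- A monomial is its exponent vector; a polynomial is a finite formal sum
-- of terms (coefficient , monomial).  Its meaning is the coefficient map.

Mono : ℕ → Set
Mono n = Vec ℕ n

Poly : ℕ → Set
Poly n = List (ℚ × Mono n)

coeff : ∀ {n} → Poly n → Mono n → ℚ
coeff [] m = 0ℚ
coeff ((c , m′) ∷ p) m = (if ⌊ ≡-dec _≟ℕ_ m′ m ⌋ then c else 0ℚ) + coeff p m

_∈mon_ : ∀ {n} → Mono n → Poly n → Set
m ∈mon p = ¬ (coeff p m ≡ 0ℚ)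

_∈var_ : ∀ {n} → Fin n → Poly n → Set
x ∈var p = ∃ λ m → m ∈mon p × ¬ (lookup m x ≡ 0)

mdeg : ∀ {n} → Mono n → ℕ
mdeg = vsum

DegreeIs : ∀ {n} → Poly n → ℕ → Set
DegreeIs p e = (∃ λ m → m ∈mon p × mdeg m ≡ e) × (∀ m → m ∈mon p → mdeg m ≤ e)

-- p has degree less than d (the zero polynomial has no degree)
DegLess : ∀ {n} → ℕ → Poly n → Set
DegLess d p = ∃ λ e → e < d × DegreeIs p e

Homogeneous : ∀ {n} → Poly n → ℕ → Set
Homogeneous p d = (∃ λ m → m ∈mon p) × (∀ m → m ∈mon p → mdeg m ≡ d)

Multilinear : ∀ {n} → Poly n → Set
Multilinear p = ∀ m → m ∈mon p → ∀ x → lookup m x ≤ 1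

IsConst : ∀ {n} → Poly n → Set
IsConst p = ∀ m → m ∈mon p → mdeg m ≡ 0

MonotonePoly : ∀ {n} → Poly n → Set
MonotonePoly p = ∀ m → 0ℚ ≤ℚ coeff p m

_⊕_ : ∀ {n} → Poly n → Poly n → Poly n
_⊕_ = _++_

_⊗_ : ∀ {n} → Poly n → Poly n → Poly n
p ⊗ q = concatMap (λ { (c , m) → map (λ { (c′ , m′) → (c * c′ , zipWith _+ℕ_ m m′) }) q }) p

constP : ∀ {n} → ℚ → Poly n
constP {n} c = (c , replicate n 0) ∷ []

varP : ∀ {n} → Fin n → Poly n
varP {n} x = (1ℚ , (replicate n 0 [ x ]≔ 1)) ∷ []

sumP : ∀ {n ℓ} → (Fin ℓ → Poly n) → Poly n
sumP {ℓ = ℓ} P = concat (List.tabulate {n = ℓ} P)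

-- V_1 = the `a` leaves.  A layer after a previous layer of size b is a
-- nonempty vector of gates whose children are either a leaf (inj₁) or a node
-- of the previous layer (inj₂).  For layer 2 the "previous layer" is V_1
-- itself.  `end o` closes the circuit, designating node o of the last layer
-- (of V_1 if there are no further layers) as the output.

data Op : Set where
  plus times : Op

data Leaf (n : ℕ) : Set where
  var   : Fin n → Leaf n
  const : ℚ → Leaf n

record Gate (a b : ℕ) : Set where
  constructor gate
  field
    op    : Op
    left  : Fin a ⊎ Fin b
    right : Fin a ⊎ Fin b
open Gate public

data Layers (a : ℕ) : ℕ → Set where
  end : ∀ {b} → Fin b → Layers a b
  _∷_ : ∀ {b k} → Vec (Gate a b) (suc k) → Layers a (suc k) → Layers a b

record Circuit (n : ℕ) : Set where
  constructor circuit
  field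
    a      : ℕ
    leaves : Vec (Leaf n) a
    body   : Layers a a
open Circuit public

-- internal nodes (layers 2..t)
data GNode {a : ℕ} : ∀ {b} → Layers a b → Set where
  here  : ∀ {b k} {v : Vec (Gate a b) (suc k)} {L} → Fin (suc k) → GNode (v ∷ L)
  there : ∀ {b k} {v : Vec (Gate a b) (suc k)} {L} → GNode L → GNode (v ∷ L)

Node : ∀ {n} → Circuit n → Set
Node C = Fin (a C) ⊎ GNode (body C)

widthL : ∀ {a b} → Layers a b → ℕ
widthL (end _) = 0
widthL (_∷_ {k = k} v L) = suc k ⊔ widthL L

sizeL : ∀ {a b} → Layers a b → ℕ
sizeL (end _) = 0
sizeL (_∷_ {k = k} v L) = suc k +ℕ sizeL L

width : ∀ {n} → Circuit n → ℕ
width C = widthL (body C)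

size : ∀ {n} → Circuit n → ℕ
size C = a C +ℕ sizeL (body C)

leafPoly : ∀ {n} → Leaf n → Poly n
leafPoly (var x) = varP x
leafPoly (const c) = constP c

applyOp : ∀ {n} → Op → Poly n → Poly n → Poly n
applyOp plus p q = p ⊕ q
applyOp times p q = p ⊗ q

childPoly : ∀ {n a b} → Vec (Poly n) a → Vec (Poly n) b → Fin a ⊎ Fin b → Poly n
childPoly lv pv (inj₁ i) = lookup lv i
childPoly lv pv (inj₂ j) = lookup pv j

gatePoly : ∀ {n a b} → Vec (Poly n) a → Vec (Poly n) b → Gate a b → Poly n
gatePoly lv pv g = applyOp (op g) (childPoly lv pv (left g)) (childPoly lv pv (right g))

outL : ∀ {n a b} → Vec (Poly n) a → Vec (Poly n) b → Layers a b → Poly n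
outL lv pv (end o) = lookup pv o
outL lv pv (v ∷ L) = outL lv (Data.Vec.map (gatePoly lv pv) v) L

gInfo : ∀ {n a b} → Vec (Poly n) a → Vec (Poly n) b → (L : Layers a b) → GNode L →
        Op × Poly n × Poly n
gInfo lv pv (v ∷ L) (here i) with lookup v i
... | gate o l r = o , childPoly lv pv l , childPoly lv pv r
gInfo lv pv (v ∷ L) (there g) = gInfo lv (Data.Vec.map (gatePoly lv pv) v) L g

leafPolys : ∀ {n} (C : Circuit n) → Vec (Poly n) (a C)
leafPolys C = Data.Vec.map leafPoly (leaves C)

nodeInfo : ∀ {n} (C : Circuit n) → GNode (body C) → Op × Poly n × Poly n
nodeInfo C g = gInfo (leafPolys C) (leafPolys C) (body C) g

nodePoly : ∀ {n} (C : Circuit n) → Node C → Poly n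
nodePoly C (inj₁ i) = lookup (leafPolys C) i
nodePoly C (inj₂ g) with nodeInfo C g
... | o , p , q = applyOp o p q

output : ∀ {n} → Circuit n → Poly n
output C = outL (leafPolys C) (leafPolys C) (body C)

-- Paths to the output.
-- Reaches L R : some node referenced (relative to L) by a reference
-- satisfying R has a path to the output.

IsChildOf : ∀ {a b} → (Fin a ⊎ Fin b → Set) → Gate a b → Set
IsChildOf R g = R (left g) ⊎ R (right g)

Reaches : ∀ {a b} → (L : Layers a b) → (Fin a ⊎ Fin b → Set) → Set
Reaches (end o) R = R (inj₂ o)
Reaches {a} (_∷_ {k = k} v L) R =
  (∃ λ (j : Fin (suc k)) → IsChildOf R (lookup v j) × Reaches L (λ c → c ≡ inj₂ j))
  ⊎ Reaches L leafPart
  where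
  leafPart : Fin a ⊎ Fin (suc k) → Set
  leafPart (inj₁ i) = R (inj₁ i)
  leafPart (inj₂ _) = ⊥

-- references to leaf i from the first layer (both forms denote leaf i there)
LeafRef : ∀ {a} → Fin a → Fin a ⊎ Fin a → Set
LeafRef i c = c ≡ inj₁ i ⊎ c ≡ inj₂ i

GReaches : ∀ {a b} → (L : Layers a b) → GNode L → Set
GReaches (v ∷ L) (here i) = Reaches L (λ c → c ≡ inj₂ i)
GReaches (v ∷ L) (there g) = GReaches L g

PathToOutput : ∀ {n} (C : Circuit n) → Node C → Set
PathToOutput C (inj₁ i) = Reaches (body C) (LeafRef i)
PathToOutput C (inj₂ g) = GReaches (body C) g

-- "the next layer contains a sum gate having this node as a child"
-- (trivially true when the node is in the last layer V_t)

NextSum : ∀ {a b} → Layers a b → (Fin a ⊎ Fin b → Set) → Set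
NextSum (end _) R = ⊤
NextSum (_∷_ {k = k} v L) R =
  ∃ λ (j : Fin (suc k)) → op (lookup v j) ≡ plus × IsChildOf R (lookup v j)

GNextSum : ∀ {a b} → (L : Layers a b) → GNode L → Set
GNextSum (v ∷ L) (here i) = NextSum L (λ c → c ≡ inj₂ i)
GNextSum (v ∷ L) (there g) = GNextSum L g

HasSumParentNext : ∀ {n} (C : Circuit n) → Node C → Set
HasSumParentNext C (inj₁ i) = NextSum (body C) (LeafRef i)
HasSumParentNext C (inj₂ g) = GNextSum (body C) g

MonotoneCircuit : ∀ {n} → Circuit n → Set
MonotoneCircuit C = ∀ i c → lookup (leaves C) i ≡ const c → 0ℚ ≤ℚ c

SameMon : ∀ {n} → Poly n → Poly n → Set
SameMon p q = ∀ m → (m ∈mon p → m ∈mon q) × (m ∈mon q → m ∈mon p)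

Minimal : ∀ {n} → Circuit n → Set
Minimal {n} C = ∀ (C′ : Circuit n) → MonotoneCircuit C′ → width C′ ≡ width C →
  SameMon (output C′) (output C) → size C Data.Nat.≤ size C′

record Good {n : ℕ} (C : Circuit n) : Set where
  field
    monotone : MonotoneCircuit C
    minimal  : Minimal C
    consts01 : ∀ i c → lookup (leaves C) i ≡ const c → c ≡ 0ℚ ⊎ c ≡ 1ℚ
    noConstMult : ∀ (g : GNode (body C)) o p q → nodeInfo C g ≡ (o , p , q) →
      o ≡ times → ¬ IsConst p × ¬ IsConst q
    allReach : ∀ (g : Node C) → PathToOutput C g
    sumParent : ∀ d → Homogeneous (output C) d → Multilinear (output C) →
      ∀ (g : Node C) → DegreeIs (nodePoly C g) d → HasSumParentNext C g

ProdOfDegLess : ∀ {n} → ℕ → (C : Circuit n) → Node C → Set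
ProdOfDegLess d C (inj₁ _) = ⊥
ProdOfDegLess d C (inj₂ g) =
  ∃ λ p → ∃ λ q → nodeInfo C g ≡ (times , p , q) × DegLess d p × DegLess d q

{-# OPTIONS --safe #-}
-- Every node p of a good circuit survives in the output: along its path to the
-- output, sum gates keep its monomials and product gates (whose factors are not
-- constant) multiply them by a monomial, so m·mon(p) ⊆ mon(C) ⊆ mon(f) for some
-- monomial m.  Two monomials of f sharing a variable lie in the same block P_i.
-- If deg p = e < d, homogeneity gives deg m = d − e ≥ 1, so all the m·u share a
-- variable of m, hence lie in one block, and this block contains var(p).  For a
-- product of nonconstant p and q, m·b·c is linked to a fixed m·b₁·c₁ through
-- m·b·c₁ or m·b₁·c.  A constant node would survive with m = 1 and put a monomial
-- of degree 0 < d into mon(C), so var(p) is never empty.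
module Submission where

open import Defs
open import Data.Nat as ℕ using (ℕ; zero; suc; _≤_) renaming (_+_ to _+ℕ_)
import Data.Nat.Properties as ℕP
open import Algebra.Properties.CommutativeSemigroup ℕP.+-commutativeSemigroup using (interchange)
open import Data.Fin as Fin using (Fin)
open import Data.Vec as Vec using (Vec; []; _∷_; lookup; zipWith; replicate)
import Data.Vec.Properties as VecP
open import Data.List as List using ([]; _∷_; _++_)
open import Data.List.Relation.Unary.Any as Any using (Any; here; there)
import Data.List.Relation.Unary.Any.Properties as AnyP
open import Data.List.Membership.Propositional using (find)
open import Data.List.Relation.Unary.All as All using (All; []; _∷_)
import Data.List.Relation.Unary.All.Properties as AllP
open import Data.Rational as ℚ using (ℚ; 0ℚ; 1ℚ; _+_; _*_) renaming (_≤_ to _≤ℚ_)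
import Data.Rational.Properties as ℚP
open import Data.Product using (∃; ∃!; _×_; _,_; proj₁; proj₂)
open import Data.Sum using (_⊎_; inj₁; inj₂)
open import Data.Empty using (⊥; ⊥-elim)
open import Relation.Nullary using (¬_; yes; no; ¬?; _×-dec_)
open import Relation.Nullary.Decidable using (⌊_⌋; decidable-stable)
open import Data.Bool using (if_then_else_)
open import Relation.Binary.PropositionalEquality
open import Function using (_∘′_)

private
  variable
    n : ℕ

p+q≡0⇒p≡0∧q≡0 : ∀ {p q} → 0ℚ ≤ℚ p → 0ℚ ≤ℚ q → p + q ≡ 0ℚ → p ≡ 0ℚ × q ≡ 0ℚ
p+q≡0⇒p≡0∧q≡0 {p} {q} 0≤p 0≤q p+q≡0 = ℚP.≤-antisym p≤0 0≤p , ℚP.≤-antisym q≤0 0≤q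
  where
  p≤0 : p ≤ℚ 0ℚ
  p≤0 = subst₂ _≤ℚ_ (ℚP.+-identityʳ p) p+q≡0 (ℚP.+-monoʳ-≤ p 0≤q)
  q≤0 : q ≤ℚ 0ℚ
  q≤0 = subst₂ _≤ℚ_ (ℚP.+-identityˡ q) p+q≡0 (ℚP.+-monoˡ-≤ q 0≤p)

p*q≢0 : ∀ {p q} → p ≢ 0ℚ → q ≢ 0ℚ → p * q ≢ 0ℚ
p*q≢0 {p} {q} p≢0 q≢0 p*q≡0 = q≢0 (begin
  q                ≡⟨ sym (ℚP.*-identityˡ q) ⟩
  1ℚ * q           ≡⟨ cong (_* q) (sym (ℚP.*-inverseˡ p)) ⟩
  ℚ.1/ p * p * q   ≡⟨ ℚP.*-assoc (ℚ.1/ p) p q ⟩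
  ℚ.1/ p * (p * q) ≡⟨ cong (ℚ.1/ p *_) p*q≡0 ⟩
  ℚ.1/ p * 0ℚ      ≡⟨ ℚP.*-zeroʳ (ℚ.1/ p) ⟩
  0ℚ               ∎)
  where
  open ≡-Reasoning
  instance
    p-nonZero : ℚ.NonZero p
    p-nonZero = ℚ.≢-nonZero p≢0

p*q≢0⇒p≢0 : ∀ {p q} → p * q ≢ 0ℚ → p ≢ 0ℚ
p*q≢0⇒p≢0 {q = q} p*q≢0 refl = p*q≢0 (ℚP.*-zeroˡ q)

p*q≢0⇒q≢0 : ∀ {p q} → p * q ≢ 0ℚ → q ≢ 0ℚ
p*q≢0⇒q≢0 {p = p} p*q≢0 refl = p*q≢0 (ℚP.*-zeroʳ p)

0≤p*q : ∀ {p q} → 0ℚ ≤ℚ p → 0ℚ ≤ℚ q → 0ℚ ≤ℚ p * q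
0≤p*q {p} {q} 0≤p 0≤q = ℚP.nonNegative⁻¹ (p * q)
  {{ℚP.nonNeg*nonNeg⇒nonNeg p {{ℚ.nonNegative 0≤p}} q {{ℚ.nonNegative 0≤q}}}}

infixl 7 _·_
_·_ : Mono n → Mono n → Mono n
_·_ = zipWith _+ℕ_

·-assoc : (u v w : Mono n) → u · v · w ≡ u · (v · w)
·-assoc = VecP.zipWith-assoc ℕP.+-assoc

·-comm : (u v : Mono n) → u · v ≡ v · u
·-comm = VecP.zipWith-comm ℕP.+-comm

·-identityˡ : (u : Mono n) → replicate n 0 · u ≡ u
·-identityˡ = VecP.zipWith-identityˡ ℕP.+-identityˡ

mdeg-· : (u v : Mono n) → mdeg (u · v) ≡ mdeg u +ℕ mdeg v
mdeg-· [] [] = refl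
mdeg-· (x ∷ u) (y ∷ v) = trans (cong (x +ℕ y +ℕ_) (mdeg-· u v)) (interchange x y (mdeg u) (mdeg v))

lookup-· : (u v : Mono n) (x : Fin n) → lookup (u · v) x ≡ lookup u x +ℕ lookup v x
lookup-· u v x = VecP.lookup-zipWith _+ℕ_ x u v

_occursIn_ : Fin n → Mono n → Set
x occursIn u = lookup u x ≢ 0

occursIn-·ˡ : ∀ {x} (u v : Mono n) → x occursIn u → x occursIn (u · v)
occursIn-·ˡ {x = x} u v x∈u e = x∈u (ℕP.m+n≡0⇒m≡0 _ (trans (sym (lookup-· u v x)) e))

occursIn-·ʳ : ∀ {x} (u v : Mono n) → x occursIn v → x occursIn (u · v)
occursIn-·ʳ {x = x} u v x∈v e = x∈v (ℕP.m+n≡0⇒n≡0 (lookup u x) (trans (sym (lookup-· u v x)) e))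

occursIn-·⁻ : ∀ {x} (u v : Mono n) → x occursIn (u · v) → x occursIn u ⊎ x occursIn v
occursIn-·⁻ {x = x} u v x∈uv with lookup u x ℕ.≟ 0
... | no x∈u = inj₁ x∈u
... | yes x∉u = inj₂ λ x∉v → x∈uv (trans (lookup-· u v x) (cong₂ _+ℕ_ x∉u x∉v))

mdeg≢0⇒occursIn : (u : Mono n) → mdeg u ≢ 0 → ∃ λ x → x occursIn u
mdeg≢0⇒occursIn [] deg≢0 = ⊥-elim (deg≢0 refl)
mdeg≢0⇒occursIn (suc _ ∷ u) _ = Fin.zero , λ ()
mdeg≢0⇒occursIn (zero ∷ u) deg≢0 with mdeg≢0⇒occursIn u deg≢0
... | x , x∈u = Fin.suc x , x∈u

-- A polynomial is a formal sum, so mon(p) is read off summed coefficients; its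
-- syntactic support agrees with mon(p) only when no terms cancel.
_∈supp_ : Mono n → Poly n → Set
u ∈supp p = Any (λ t → proj₂ t ≡ u × proj₁ t ≢ 0ℚ) p

NonNeg : Poly n → Set
NonNeg p = All (λ t → 0ℚ ≤ℚ proj₁ t) p

ConstantSupp : Poly n → Set
ConstantSupp r = ∀ {u} → u ∈supp r → mdeg u ≡ 0

HomogeneousSupp : Poly n → ℕ → Set
HomogeneousSupp r d = ∀ {u} → u ∈supp r → mdeg u ≡ d

coeff-nonNeg : ∀ {p : Poly n} u → NonNeg p → 0ℚ ≤ℚ coeff p u
coeff-nonNeg u [] = ℚP.≤-refl
coeff-nonNeg {p = (_ , m) ∷ _} u (0≤α ∷ p≥0) with VecP.≡-dec ℕ._≟_ m u
... | yes _ = ℚP.+-mono-≤ 0≤α (coeff-nonNeg u p≥0)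
... | no _ = ℚP.+-mono-≤ ℚP.≤-refl (coeff-nonNeg u p≥0)

∈supp⇒∈mon : ∀ {p : Poly n} {u} → NonNeg p → u ∈supp p → u ∈mon p
∈supp⇒∈mon {u = u} (0≤α ∷ p≥0) (here (refl , α≢0)) coeff≡0 with VecP.≡-dec ℕ._≟_ u u
... | yes _ = α≢0 (proj₁ (p+q≡0⇒p≡0∧q≡0 0≤α (coeff-nonNeg u p≥0) coeff≡0))
... | no u≢u = u≢u refl
∈supp⇒∈mon {p = (_ , m) ∷ _} {u} (0≤α ∷ p≥0) (there u∈p) coeff≡0 with VecP.≡-dec ℕ._≟_ m u
... | yes _ = ∈supp⇒∈mon p≥0 u∈p (proj₂ (p+q≡0⇒p≡0∧q≡0 0≤α (coeff-nonNeg u p≥0) coeff≡0))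
... | no _ = ∈supp⇒∈mon p≥0 u∈p (proj₂ (p+q≡0⇒p≡0∧q≡0 ℚP.≤-refl (coeff-nonNeg u p≥0) coeff≡0))

∈mon⇒∈supp : (p : Poly n) {u : Mono n} → u ∈mon p → u ∈supp p
∈mon⇒∈supp [] u∈p = ⊥-elim (u∈p refl)
∈mon⇒∈supp ((α , m) ∷ p) {u} u∈p with VecP.≡-dec ℕ._≟_ m u | α ℚ.≟ 0ℚ
... | yes m≡u | no α≢0 = here (m≡u , α≢0)
... | yes _ | yes refl = there (∈mon⇒∈supp p λ e → u∈p (trans (ℚP.+-identityˡ _) e))
... | no _ | _ = there (∈mon⇒∈supp p λ e → u∈p (trans (ℚP.+-identityˡ _) e))

coeff-++ : (p q : Poly n) (u : Mono n) → coeff (p ++ q) u ≡ coeff p u + coeff q u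
coeff-++ [] q u = sym (ℚP.+-identityˡ _)
coeff-++ ((α , m) ∷ p) q u =
  trans (cong (α′ +_) (coeff-++ p q u)) (sym (ℚP.+-assoc α′ (coeff p u) (coeff q u)))
  where α′ = if ⌊ VecP.≡-dec ℕ._≟_ m u ⌋ then α else 0ℚ

∈mon-++⁻ : (p q : Poly n) {u : Mono n} → u ∈mon (p ++ q) → u ∈mon p ⊎ u ∈mon q
∈mon-++⁻ p q {u} u∈pq with coeff p u ℚ.≟ 0ℚ
... | no u∈p = inj₁ u∈p
... | yes u∉p = inj₂ λ u∉q → u∈pq (trans (coeff-++ p q u) (trans (cong₂ _+_ u∉p u∉q) (ℚP.+-identityˡ 0ℚ)))

∈mon-sumP⁻ : ∀ {ℓ} (P : Fin ℓ → Poly n) {u} → u ∈mon sumP P → ∃ λ k → u ∈mon P k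
∈mon-sumP⁻ {ℓ = zero} P u∈P = ⊥-elim (u∈P refl)
∈mon-sumP⁻ {ℓ = suc ℓ} P u∈P with ∈mon-++⁻ (P Fin.zero) (sumP (λ i → P (Fin.suc i))) u∈P
... | inj₁ u∈P₀ = Fin.zero , u∈P₀
... | inj₂ u∈P′ with ∈mon-sumP⁻ (λ i → P (Fin.suc i)) u∈P′
...   | k , u∈Pₖ = Fin.suc k , u∈Pₖ

constantSupp⇒IsConst : (p : Poly n) → ConstantSupp p → IsConst p
constantSupp⇒IsConst p p-const u u∈p = p-const (∈mon⇒∈supp p u∈p)

nonConst⇒∈supp-deg≢0 : (p : Poly n) → ¬ IsConst p → ∃ λ u → u ∈supp p × mdeg u ≢ 0
nonConst⇒∈supp-deg≢0 p nonConst
  with Any.any? (λ t → ¬? (proj₁ t ℚ.≟ 0ℚ) ×-dec ¬? (mdeg (proj₂ t) ℕ.≟ 0)) p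
... | yes found with find found
...   | (_ , u) , t∈p , α≢0 , deg≢0 = u , Any.map (λ { refl → refl , α≢0 }) t∈p , deg≢0
nonConst⇒∈supp-deg≢0 p nonConst | no none = ⊥-elim (nonConst λ u u∈p →
  decidable-stable (mdeg u ℕ.≟ 0) λ deg≢0 →
    none (Any.map (λ { (refl , α≢0) → α≢0 , deg≢0 }) (∈mon⇒∈supp p u∈p)))

termMul : ℚ → Mono n → ℚ × Mono n → ℚ × Mono n
termMul α m (β , u) = α * β , m · u

nonNeg-++ : {p q : Poly n} → NonNeg p → NonNeg q → NonNeg (p ++ q)
nonNeg-++ = AllP.++⁺

nonNeg-⊗ : {p q : Poly n} → NonNeg p → NonNeg q → NonNeg (p ⊗ q)
nonNeg-⊗ [] q≥0 = []
nonNeg-⊗ (0≤α ∷ p≥0) q≥0 =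
  AllP.++⁺ (AllP.map⁺ (All.map (0≤p*q 0≤α) q≥0)) (nonNeg-⊗ p≥0 q≥0)

∈supp-⊗ : (p q : Poly n) {b c : Mono n} → b ∈supp p → c ∈supp q → (b · c) ∈supp (p ⊗ q)
∈supp-⊗ ((α , b) ∷ p) q (here (refl , α≢0)) c∈q =
  AnyP.++⁺ˡ (AnyP.map⁺ (Any.map (λ { (refl , β≢0) → refl , p*q≢0 α≢0 β≢0 }) c∈q))
∈supp-⊗ (_ ∷ p) q (there b∈p) c∈q = AnyP.++⁺ʳ _ (∈supp-⊗ p q b∈p c∈q)

∈supp-⊗⁻ : (p q : Poly n) {u : Mono n} → u ∈supp (p ⊗ q) →
  ∃ λ b → ∃ λ c → b ∈supp p × c ∈supp q × u ≡ b · c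
∈supp-⊗⁻ ((α , b) ∷ p) q u∈pq with AnyP.++⁻ (List.map (termMul α b) q) u∈pq
... | inj₁ u∈bq = b , scaled q (AnyP.map⁻ u∈bq)
  where
  scaled : ∀ q {u} → Any (λ t → b · proj₂ t ≡ u × α * proj₁ t ≢ 0ℚ) q →
    ∃ λ c → (b ∈supp ((α , b) ∷ p)) × c ∈supp q × u ≡ b · c
  scaled (_ ∷ _) (here (refl , αβ≢0)) =
    _ , here (refl , p*q≢0⇒p≢0 αβ≢0) , here (refl , p*q≢0⇒q≢0 {α} αβ≢0) , refl
  scaled (_ ∷ q) (there u∈bq) with scaled q u∈bq
  ... | c , b∈p , c∈q , u≡bc = c , b∈p , there c∈q , u≡bc
... | inj₂ u∈pq′ with ∈supp-⊗⁻ p q u∈pq′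
...   | b′ , c , b′∈p , c∈q , u≡b′c = b′ , c , there b′∈p , c∈q , u≡b′c

-- The paper's "mon(m·r) ⊆ mon(out) for some monomial m", strengthened so that a
-- constant r survives with m = 1; this is what rules out nonzero constant nodes.
record Survives (out r : Poly n) : Set where
  field
    cofactor      : Mono n
    shift         : ∀ {u} → u ∈supp r → (cofactor · u) ∈supp out
    keep-constant : ConstantSupp r → ∀ {u} → u ∈supp r → u ∈supp out

module _ {out : Poly n} where

  survives-refl : Survives out out
  survives-refl = record
    { cofactor      = replicate _ 0
    ; shift         = λ {u} u∈out → subst (_∈supp out) (sym (·-identityˡ u)) u∈out
    ; keep-constant = λ _ u∈out → u∈out
    }

  deg≡0⇒constantSupp : ∀ {d r} → HomogeneousSupp out d → (S : Survives out r) →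
    ∀ {u} → u ∈supp r → mdeg u ≡ 0 → ConstantSupp r
  deg≡0⇒constantSupp homog S {u} u∈r deg≡0 {w} w∈r = ℕP.+-cancelˡ-≡ (mdeg m) _ _ (begin
    mdeg m +ℕ mdeg w ≡⟨ sym (mdeg-· m w) ⟩
    mdeg (m · w)     ≡⟨ homog (shift w∈r) ⟩
    _                ≡⟨ sym (homog (shift u∈r)) ⟩
    mdeg (m · u)     ≡⟨ mdeg-· m u ⟩
    mdeg m +ℕ mdeg u ≡⟨ cong (mdeg m +ℕ_) deg≡0 ⟩
    mdeg m +ℕ 0      ∎)
    where
    open ≡-Reasoning
    open Survives S renaming (cofactor to m)

  survives-⊆ : ∀ {d p r} → HomogeneousSupp out d → (∀ {u} → u ∈supp p → u ∈supp r) →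
    Survives out r → Survives out p
  survives-⊆ homog p⊆r S = record
    { cofactor      = cofactor
    ; shift         = λ u∈p → shift (p⊆r u∈p)
    ; keep-constant = λ p-const u∈p →
        keep-constant (deg≡0⇒constantSupp homog S (p⊆r u∈p) (p-const u∈p)) (p⊆r u∈p)
    }
    where open Survives S

  survives-⊗ʳ : (p q : Poly n) → ¬ IsConst p → ¬ IsConst q → Survives out (p ⊗ q) → Survives out q
  survives-⊗ʳ p q p-nonConst q-nonConst S = record
    { cofactor      = cofactor · b
    ; shift         = λ {u} u∈q →
        subst (_∈supp out) (sym (·-assoc cofactor b u)) (shift (∈supp-⊗ p q b∈p u∈q))
    ; keep-constant = λ q-const → ⊥-elim (q-nonConst (constantSupp⇒IsConst q q-const))
    }
    where
    open Survives S
    b = proj₁ (nonConst⇒∈supp-deg≢0 p p-nonConst)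
    b∈p = proj₁ (proj₂ (nonConst⇒∈supp-deg≢0 p p-nonConst))

  survives-⊗ˡ : (p q : Poly n) → ¬ IsConst p → ¬ IsConst q → Survives out (p ⊗ q) → Survives out p
  survives-⊗ˡ p q p-nonConst q-nonConst S = record
    { cofactor      = cofactor · c
    ; shift         = λ {u} u∈p → subst (_∈supp out) (reorder u) (shift (∈supp-⊗ p q u∈p c∈q))
    ; keep-constant = λ p-const → ⊥-elim (p-nonConst (constantSupp⇒IsConst p p-const))
    }
    where
    open Survives S
    c = proj₁ (nonConst⇒∈supp-deg≢0 q q-nonConst)
    c∈q = proj₁ (proj₂ (nonConst⇒∈supp-deg≢0 q q-nonConst))
    reorder : ∀ u → cofactor · (u · c) ≡ cofactor · c · u
    reorder u = trans (cong (cofactor ·_) (·-comm u c)) (sym (·-assoc cofactor c u))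

infoPoly : Op × Poly n × Poly n → Poly n
infoPoly (o , p , q) = applyOp o p q

gateInfo : ∀ {a b} → Vec (Poly n) a → Vec (Poly n) b → Gate a b → Op × Poly n × Poly n
gateInfo lv pv G = op G , childPoly lv pv (left G) , childPoly lv pv (right G)

gInfo-here : ∀ {a b k} (lv : Vec (Poly n) a) (pv : Vec (Poly n) b) (v : Vec (Gate a b) (suc k)) L i →
  gInfo lv pv (v ∷ L) (here i) ≡ gateInfo lv pv (lookup v i)
gInfo-here lv pv v L i with lookup v i
... | gate _ _ _ = refl

nodePoly-inj₂ : (C : Circuit n) (g : GNode (body C)) → nodePoly C (inj₂ g) ≡ infoPoly (nodeInfo C g)
nodePoly-inj₂ C g with nodeInfo C g
... | _ = refl

nonNeg-applyOp : ∀ o {p q : Poly n} → NonNeg p → NonNeg q → NonNeg (applyOp o p q)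
nonNeg-applyOp plus = nonNeg-++
nonNeg-applyOp times = nonNeg-⊗

AllNonNeg : ∀ {b} → Vec (Poly n) b → Set
AllNonNeg pv = ∀ j → NonNeg (lookup pv j)

module _ {a} {lv : Vec (Poly n) a} (lv≥0 : AllNonNeg lv) where

  nonNeg-childPoly : ∀ {b} {pv : Vec (Poly n) b} → AllNonNeg pv → ∀ c → NonNeg (childPoly lv pv c)
  nonNeg-childPoly pv≥0 (inj₁ i) = lv≥0 i
  nonNeg-childPoly pv≥0 (inj₂ j) = pv≥0 j

  nonNeg-gatePoly : ∀ {b} {pv : Vec (Poly n) b} → AllNonNeg pv → (G : Gate a b) → NonNeg (gatePoly lv pv G)
  nonNeg-gatePoly pv≥0 G =
    nonNeg-applyOp (op G) (nonNeg-childPoly pv≥0 (left G)) (nonNeg-childPoly pv≥0 (right G))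

  nonNeg-nextLayer : ∀ {b k} {pv : Vec (Poly n) b} → AllNonNeg pv → (v : Vec (Gate a b) k) →
    AllNonNeg (Vec.map (gatePoly lv pv) v)
  nonNeg-nextLayer pv≥0 v j =
    subst NonNeg (sym (VecP.lookup-map j (gatePoly lv _) v)) (nonNeg-gatePoly pv≥0 (lookup v j))

  nonNeg-outL : ∀ {b} {pv : Vec (Poly n) b} → AllNonNeg pv → (L : Layers a b) → NonNeg (outL lv pv L)
  nonNeg-outL pv≥0 (end o) = pv≥0 o
  nonNeg-outL pv≥0 (v ∷ L) = nonNeg-outL (nonNeg-nextLayer pv≥0 v) L

  nonNeg-gInfo : ∀ {b} {pv : Vec (Poly n) b} → AllNonNeg pv → (L : Layers a b) (g : GNode L) →
    NonNeg (infoPoly (gInfo lv pv L g))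
  nonNeg-gInfo pv≥0 (v ∷ L) (here i) =
    subst (λ t → NonNeg (infoPoly t)) (sym (gInfo-here lv _ v L i)) (nonNeg-gatePoly pv≥0 (lookup v i))
  nonNeg-gInfo pv≥0 (v ∷ L) (there g) = nonNeg-gInfo (nonNeg-nextLayer pv≥0 v) L g

module _ (C : Circuit n) (monotone : MonotoneCircuit C) where

  nonNeg-leafPolys : AllNonNeg (leafPolys C)
  nonNeg-leafPolys i rewrite VecP.lookup-map i leafPoly (leaves C) with lookup (leaves C) i in eq
  ... | var _ = ℚP.nonNegative⁻¹ 1ℚ ∷ []
  ... | const c = monotone i c eq ∷ []

  nonNeg-output : NonNeg (output C)
  nonNeg-output = nonNeg-outL nonNeg-leafPolys nonNeg-leafPolys (body C)

  nonNeg-nodePoly : ∀ g → NonNeg (nodePoly C g)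
  nonNeg-nodePoly (inj₁ i) = nonNeg-leafPolys i
  nonNeg-nodePoly (inj₂ g) =
    subst NonNeg (sym (nodePoly-inj₂ C g)) (nonNeg-gInfo nonNeg-leafPolys nonNeg-leafPolys (body C) g)

NoConstFactors : ∀ {a b} → Vec (Poly n) a → Vec (Poly n) b → Layers a b → Set
NoConstFactors lv pv L =
  ∀ g o p q → gInfo lv pv L g ≡ (o , p , q) → o ≡ times → ¬ IsConst p × ¬ IsConst q

module _ {a d : ℕ} (lv : Vec (Poly n) a) where

  survives-child : ∀ {b} {pv : Vec (Poly n) b} {out} → HomogeneousSupp out d → (G : Gate a b) →
    (op G ≡ times → ¬ IsConst (childPoly lv pv (left G)) × ¬ IsConst (childPoly lv pv (right G))) →
    Survives out (gatePoly lv pv G) →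
    ∀ {R} → IsChildOf R G → ∃ λ c → R c × Survives out (childPoly lv pv c)
  survives-child homog (gate plus l r) _ S (inj₁ Rl) = l , Rl , survives-⊆ homog AnyP.++⁺ˡ S
  survives-child homog (gate plus l r) _ S (inj₂ Rr) = r , Rr , survives-⊆ homog (AnyP.++⁺ʳ _) S
  survives-child homog (gate times l r) nonConst S (inj₁ Rl) =
    l , Rl , survives-⊗ˡ (childPoly lv _ l) (childPoly lv _ r) (proj₁ (nonConst refl)) (proj₂ (nonConst refl)) S
  survives-child homog (gate times l r) nonConst S (inj₂ Rr) =
    r , Rr , survives-⊗ʳ (childPoly lv _ l) (childPoly lv _ r) (proj₁ (nonConst refl)) (proj₂ (nonConst refl)) S

  survives-reached : ∀ {b} (L : Layers a b) {pv : Vec (Poly n) b} → NoConstFactors lv pv L →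
    HomogeneousSupp (outL lv pv L) d →
    ∀ {R} → Reaches L R → ∃ λ c → R c × Survives (outL lv pv L) (childPoly lv pv c)
  survives-reached (end o) _ _ Ro = inj₂ o , Ro , survives-refl
  survives-reached (v ∷ L) {pv} nonConst homog (inj₁ (j , j-parent , reach))
    with survives-reached L (λ g → nonConst (there g)) homog reach
  ... | .(inj₂ j) , refl , S =
    survives-child homog (lookup v j) (nonConst (here j) _ _ _ (gInfo-here lv pv v L j))
      (subst (Survives _) (VecP.lookup-map j (gatePoly lv pv) v) S) j-parent
  survives-reached (v ∷ L) nonConst homog (inj₂ reach)
    with survives-reached L (λ g → nonConst (there g)) homog reach
  ... | inj₁ i , Ri , S = inj₁ i , Ri , S

  survives-gNode : ∀ {b} (L : Layers a b) {pv : Vec (Poly n) b} → NoConstFactors lv pv L →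
    HomogeneousSupp (outL lv pv L) d →
    (g : GNode L) → GReaches L g → Survives (outL lv pv L) (infoPoly (gInfo lv pv L g))
  survives-gNode (v ∷ L) {pv} nonConst homog (here i) reach
    with survives-reached L (λ g → nonConst (there g)) homog reach
  ... | .(inj₂ i) , refl , S =
    subst (Survives _) (trans (VecP.lookup-map i (gatePoly lv pv) v) (cong infoPoly (sym (gInfo-here lv pv v L i)))) S
  survives-gNode (v ∷ L) nonConst homog (there g) reach =
    survives-gNode L (λ g → nonConst (there g)) homog g reach

module _ (C : Circuit n) (good : Good C) {d} (homog : HomogeneousSupp (output C) d) where
  open Good good

  node-survives : ∀ g → Survives (output C) (nodePoly C g)
  node-survives (inj₁ i) with survives-reached (leafPolys C) (body C) noConstMult homog (allReach (inj₁ i))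
  ... | .(inj₁ i) , inj₁ refl , S = S
  ... | .(inj₂ i) , inj₂ refl , S = S
  node-survives (inj₂ g) = subst (Survives _) (sym (nodePoly-inj₂ C g))
    (survives-gNode (leafPolys C) (body C) noConstMult homog g (allReach (inj₂ g)))

module Blocks {ℓ} (P : Fin ℓ → Poly n)
  (disjoint : ∀ (i j : Fin ℓ) → i ≢ j → ∀ (x : Fin n) → x ∈var P i → x ∈var P j → ⊥) where

  CoveredBy : Poly n → Fin ℓ → Set
  CoveredBy p i = ∀ (x : Fin n) → x ∈var p → x ∈var P i

  block-unique : ∀ {x i j} → x ∈var P i → x ∈var P j → i ≡ j
  block-unique {i = i} {j} x∈Pᵢ x∈Pⱼ with i Fin.≟ j
  ... | yes i≡j = i≡j
  ... | no i≢j = ⊥-elim (disjoint i j i≢j _ x∈Pᵢ x∈Pⱼ)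

  covering-block-unique : ∀ {p x k} → x ∈var p → CoveredBy p k → ∃! _≡_ (CoveredBy p)
  covering-block-unique x∈p covered = _ , covered , λ covered′ → block-unique (covered _ x∈p) (covered′ _ x∈p)

  module Covering {d} (homog : ∀ m → m ∈mon sumP P → mdeg m ≡ d)
    {out : Poly n} (out≥0 : NonNeg out) (out⊆f : ∀ m → m ∈mon out → m ∈mon sumP P) where

    out-homog : HomogeneousSupp out d
    out-homog {w} w∈out = homog w (out⊆f w (∈supp⇒∈mon out≥0 w∈out))

    blockOf : ∀ {w} → w ∈supp out → Fin ℓ
    blockOf {w} w∈out = proj₁ (∈mon-sumP⁻ P (out⊆f w (∈supp⇒∈mon out≥0 w∈out)))

    ∈blockOf : ∀ {w} (w∈out : w ∈supp out) → w ∈mon P (blockOf w∈out)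
    ∈blockOf {w} w∈out = proj₂ (∈mon-sumP⁻ P (out⊆f w (∈supp⇒∈mon out≥0 w∈out)))

    blockOf-shared : ∀ {w w′ x} (w∈out : w ∈supp out) (w′∈out : w′ ∈supp out) →
      x occursIn w → x occursIn w′ → blockOf w∈out ≡ blockOf w′∈out
    blockOf-shared w∈out w′∈out x∈w x∈w′ =
      block-unique (_ , ∈blockOf w∈out , x∈w) (_ , ∈blockOf w′∈out , x∈w′)

    ∈var-blockOf : ∀ {m u x} (mu∈out : (m · u) ∈supp out) → x occursIn u → x ∈var P (blockOf mu∈out)
    ∈var-blockOf {m} {u} mu∈out x∈u = m · u , ∈blockOf mu∈out , occursIn-·ʳ m u x∈u

    low-degree-covered : 1 ≤ d → ∀ {r} → NonNeg r → Survives out r → DegLess d r → ∃! _≡_ (CoveredBy r)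
    low-degree-covered 1≤d {r} r≥0 S (e , e<d , (u₁ , u₁∈r , deg-u₁) , deg≤e) =
      covering-block-unique {p = r} x∈r covered
      where
      open Survives S renaming (cofactor to m)

      u₁∈supp = ∈mon⇒∈supp r u₁∈r
      mu₁∈out = shift u₁∈supp

      deg-m≢0 : mdeg m ≢ 0
      deg-m≢0 deg-m≡0 = ℕP.<-irrefl (begin
        e                 ≡⟨ cong (_+ℕ e) (sym deg-m≡0) ⟩
        mdeg m +ℕ e       ≡⟨ cong (mdeg m +ℕ_) (sym deg-u₁) ⟩
        mdeg m +ℕ mdeg u₁ ≡⟨ sym (mdeg-· m u₁) ⟩
        mdeg (m · u₁)     ≡⟨ out-homog mu₁∈out ⟩
        d                 ∎) e<d
        where open ≡-Reasoning

      y∈m = proj₂ (mdeg≢0⇒occursIn m deg-m≢0)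

      covered : CoveredBy r (blockOf mu₁∈out)
      covered x (u , u∈r , x∈u) = subst (x ∈var_ ∘′ P)
        (blockOf-shared mu∈out mu₁∈out (occursIn-·ˡ m u y∈m) (occursIn-·ˡ m u₁ y∈m))
        (∈var-blockOf mu∈out x∈u)
        where mu∈out = shift (∈mon⇒∈supp r u∈r)

      deg-u₁≢0 : mdeg u₁ ≢ 0
      deg-u₁≢0 deg-u₁≡0 = ℕP.<⇒≢ 1≤d (sym (trans (sym (out-homog (keep-constant r-const u₁∈supp))) deg-u₁≡0))
        where
        r-const : ConstantSupp r
        r-const {u} u∈r =
          ℕP.n≤0⇒n≡0 (subst (mdeg u ≤_) (trans (sym deg-u₁) deg-u₁≡0) (deg≤e u (∈supp⇒∈mon r≥0 u∈r)))

      x∈r : proj₁ (mdeg≢0⇒occursIn u₁ deg-u₁≢0) ∈var r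
      x∈r = u₁ , u₁∈r , proj₂ (mdeg≢0⇒occursIn u₁ deg-u₁≢0)

    product-covered : (p q : Poly n) → ¬ IsConst p → ¬ IsConst q →
      NonNeg (p ⊗ q) → Survives out (p ⊗ q) → ∃! _≡_ (CoveredBy (p ⊗ q))
    product-covered p q p-nonConst q-nonConst pq≥0 S = covering-block-unique {p = p ⊗ q} y₁∈pq covered
      where
      open Survives S renaming (cofactor to m)

      b₁ = proj₁ (nonConst⇒∈supp-deg≢0 p p-nonConst)
      b₁∈p = proj₁ (proj₂ (nonConst⇒∈supp-deg≢0 p p-nonConst))
      y₁∈b₁ = proj₂ (mdeg≢0⇒occursIn b₁ (proj₂ (proj₂ (nonConst⇒∈supp-deg≢0 p p-nonConst))))
      c₁ = proj₁ (nonConst⇒∈supp-deg≢0 q q-nonConst)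
      c₁∈q = proj₁ (proj₂ (nonConst⇒∈supp-deg≢0 q q-nonConst))
      y₂∈c₁ = proj₂ (mdeg≢0⇒occursIn c₁ (proj₂ (proj₂ (nonConst⇒∈supp-deg≢0 q q-nonConst))))

      term : ∀ {b c} → b ∈supp p → c ∈supp q → (m · (b · c)) ∈supp out
      term b∈p c∈q = shift (∈supp-⊗ p q b∈p c∈q)

      occursIn-termˡ : ∀ {x} b c → x occursIn b → x occursIn (m · (b · c))
      occursIn-termˡ b c x∈b = occursIn-·ʳ m (b · c) (occursIn-·ˡ b c x∈b)

      occursIn-termʳ : ∀ {x} b c → x occursIn c → x occursIn (m · (b · c))
      occursIn-termʳ b c x∈c = occursIn-·ʳ m (b · c) (occursIn-·ʳ b c x∈c)

      term-block : ∀ {b c x} (b∈p : b ∈supp p) (c∈q : c ∈supp q) → x occursIn (b · c) →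
        blockOf (term b∈p c∈q) ≡ blockOf (term b₁∈p c₁∈q)
      term-block {b} {c} b∈p c∈q x∈bc with occursIn-·⁻ b c x∈bc
      ... | inj₁ x∈b = trans
        (blockOf-shared (term b∈p c∈q) (term b∈p c₁∈q) (occursIn-termˡ b c x∈b) (occursIn-termˡ b c₁ x∈b))
        (blockOf-shared (term b∈p c₁∈q) (term b₁∈p c₁∈q) (occursIn-termʳ b c₁ y₂∈c₁) (occursIn-termʳ b₁ c₁ y₂∈c₁))
      ... | inj₂ x∈c = trans
        (blockOf-shared (term b∈p c∈q) (term b₁∈p c∈q) (occursIn-termʳ b c x∈c) (occursIn-termʳ b₁ c x∈c))
        (blockOf-shared (term b₁∈p c∈q) (term b₁∈p c₁∈q) (occursIn-termˡ b₁ c y₁∈b₁) (occursIn-termˡ b₁ c₁ y₁∈b₁))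

      covered : CoveredBy (p ⊗ q) (blockOf (term b₁∈p c₁∈q))
      covered x (u , u∈pq , x∈u) with ∈supp-⊗⁻ p q (∈mon⇒∈supp (p ⊗ q) u∈pq)
      ... | b , c , b∈p , c∈q , refl =
        subst (x ∈var_ ∘′ P) (term-block b∈p c∈q x∈u) (∈var-blockOf (term b∈p c∈q) x∈u)

      y₁∈pq : proj₁ (mdeg≢0⇒occursIn b₁ _) ∈var (p ⊗ q)
      y₁∈pq = b₁ · c₁ , ∈supp⇒∈mon pq≥0 (∈supp-⊗ p q b₁∈p c₁∈q) , occursIn-·ˡ b₁ c₁ y₁∈b₁

lemma3 : ∀ {n ℓ d : ℕ} (P : Fin ℓ → Poly n) →
  MonotonePoly (sumP P) → Homogeneous (sumP P) d → 1 ≤ d →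
  (∀ (i j : Fin ℓ) → i ≢ j → ∀ (x : Fin n) → x ∈var P i → x ∈var P j → ⊥) →
  (C : Circuit n) → Good C → (∀ m → m ∈mon output C → m ∈mon sumP P) →
  (g : Node C) → DegLess d (nodePoly C g) ⊎ ProdOfDegLess d C g →
  ∃! _≡_ (λ (i : Fin ℓ) → ∀ (x : Fin n) → x ∈var nodePoly C g → x ∈var P i)
lemma3 {d = d} P _ (_ , homog) 1≤d disjoint C good out⊆f = node-covered
  where
  open Good good
  open Blocks P disjoint
  open Covering homog (nonNeg-output C monotone) out⊆f

  survives : ∀ g → Survives (output C) (nodePoly C g)
  survives = node-survives C good out-homog

  node-covered : ∀ g → DegLess d (nodePoly C g) ⊎ ProdOfDegLess d C g → ∃! _≡_ (CoveredBy (nodePoly C g))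
  node-covered g (inj₁ deg<d) = low-degree-covered 1≤d (nonNeg-nodePoly C monotone g) (survives g) deg<d
  node-covered (inj₁ _) (inj₂ ())
  node-covered (inj₂ g) (inj₂ (p , q , info , _ , _)) =
    subst (λ r → NonNeg r → Survives (output C) r → ∃! _≡_ (CoveredBy r)) (sym node≡p⊗q)
      (product-covered p q (proj₁ nonConst) (proj₂ nonConst))
      (nonNeg-nodePoly C monotone (inj₂ g)) (survives (inj₂ g))
    where
    node≡p⊗q = trans (nodePoly-inj₂ C g) (cong infoPoly info)
    nonConst = noConstMult g times p q info refl
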